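{- Let $S$ be a c-quantale such that $x\cdot(d(y)\cdot z)=(x\cdot d(y))\cdot z$ for all $x,y,z\in S$. Then for every $x\in S$, $\nu(x)^\omega=\nabla(\nu(x))\cdot U$, where $\nu(x)=x\sqcap\overline{1}_\pi$.
   Context: A proto-quantale is $(Q,\le,\cdot)$ with $(Q,\le)$ a complete lattice, $x\le y\Rightarrow z\cdot x\le z\cdot y$, and $(\sum_{i\in I}x_i)\cdot y=\sum_{i\in I}(x_i\cdot y)$; it is unital with unit $1$ if $1\cdot x=x=x\cdot 1$. A (commutative) quantale additionally has associative (commutative) multiplication and $x\cdot\sum_i y_i=\sum_i x\cdot y_i$. A proto-bi-quantale is $(Q,\le,\cdot,\|,1_\sigma,1_\pi)$ with $(Q,\le,\cdot,1_\sigma)$ a unital proto-quantale and $(Q,\le,\|,1_\pi)$ a unital commutative quantale. A c-quantale is a proto-bi-quantale which, with $+$ the binary supremum, $\sqcap$ the binary infimum, $0$ the least and $U$ the greatest element and a distinguished element $\overline{1}_\pi$, is a c-lattice: $(Q,+,\sqcap,0,U)$ is distributive and for all $x,y,z$: (cl1) $x\cdot 1_\pi+x\cdot\overline{1}_\pi=x\cdot U$; (cl2) $1_\pi\sqcap(x+\overline{1}_\pi)=x\cdot 0$; (cl3) $x\cdot(y\|z)\le(x\cdot y)\|(x\cdot z)$; (cl4) $z\|z\le z\Rightarrow (x\|y)\cdot z=(x\cdot z)\|(y\cdot z)$; (cl5) $x\cdot(y\cdot(z\cdot 0))=(x\cdot y)\cdot(z\cdot 0)$; (cl6) $(x\cdot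 0)\cdot y=x\cdot(0\cdot y)$; (cl7) $1_\sigma\|1_\sigma=1_\sigma$; (cl8) $((x\cdot 1_\pi)\|1_\sigma)\cdot y=(x\cdot 1_\pi)\|y$; (cl9) $((x\sqcap 1_\sigma)\cdot 1_\pi)\|1_\sigma=x\sqcap 1_\sigma$; (cl10) $((x\sqcap\overline{1}_\pi)\cdot 1_\pi)\|1_\sigma=1_\sigma\sqcap((x\sqcap\overline{1}_\pi)\cdot\overline{1}_\pi)$; (cl11) $((x\sqcap\overline{1}_\pi)\cdot 1_\pi)\|\overline{1}_\pi=(x\sqcap\overline{1}_\pi)\cdot\overline{1}_\pi$. Domain: $d(x)=(x\cdot 1_\pi)\|1_\sigma$; domain elements are those $p$ with $d(p)=p$ (equivalently $p\le 1_\sigma$). For an element $y$, $y^\omega$ is the greatest fixpoint of the isotone map $z\mapsto y\cdot z$. For an element $y$, $\nabla y$ is the greatest fixpoint of the map $p\mapsto d(y\cdot p)$ on the complete lattice of domain elements, i.e. the greatest domain element $p$ with $p=d(y\cdot p)$. -}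

module Defs where

open import Level using (Level; suc; Lift; lift)
open import Data.Bool using (Bool; true; false)
open import Data.Empty using (⊥)
open import Data.Product using (Σ; _×_; proj₁)
open import Relation.Binary.PropositionalEquality using (_≡_)

record IsCompleteLattice {c : Level} (Q : Set c) (_≤_ : Q → Q → Set c)
                         (⋁ : {I : Set c} → (I → Q) → Q) : Set (suc c) where
  field
    ≤-refl    : ∀ {x} → x ≤ x
    ≤-trans   : ∀ {x y z} → x ≤ y → y ≤ z → x ≤ z
    ≤-antisym : ∀ {x y} → x ≤ y → y ≤ x → x ≡ y
    ⋁-upper   : ∀ {I : Set c} (f : I → Q) (i : I) → f i ≤ ⋁ f
    ⋁-least   : ∀ {I : Set c} (f : I → Q) (z : Q) → (∀ i → f i ≤ z) → ⋁ f ≤ z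

module LatticeOps {c : Level} (Q : Set c) (_≤_ : Q → Q → Set c)
                  (⋁ : {I : Set c} → (I → Q) → Q) where
  _+_ : Q → Q → Q
  x + y = ⋁ {Lift c Bool} (λ { (lift true) → x ; (lift false) → y })

  _⊓_ : Q → Q → Q
  x ⊓ y = ⋁ {Σ Q (λ z → (z ≤ x) × (z ≤ y))} proj₁

  𝟘 : Q
  𝟘 = ⋁ {Lift c ⊥} (λ ())

  U : Q
  U = ⋁ {Q} (λ z → z)

  infixl 6 _+_
  infixl 7 _⊓_

record CQuantale (c : Level) : Set (suc c) where
  infixl 8 _·_
  infixl 8 _∥_
  field
    Carrier : Set c
    _≤_     : Carrier → Carrier → Set c
    ⋁       : {I : Set c} → (I → Carrier) → Carrier
    _·_     : Carrier → Carrier → Carrier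
    _∥_     : Carrier → Carrier → Carrier
    1σ      : Carrier
    1π      : Carrier
    1̄π      : Carrier
    isCompleteLattice : IsCompleteLattice Carrier _≤_ ⋁

  open LatticeOps Carrier _≤_ ⋁ public

  field
    -- (Carrier, ≤, ·, 1σ) is a unital proto-quantale
    ·-monoʳ   : ∀ {x y} z → x ≤ y → (z · x) ≤ (z · y)
    ·-⋁-distˡ : ∀ {I : Set c} (f : I → Carrier) y → (⋁ f) · y ≡ ⋁ (λ i → f i · y)
    ·-identityˡ : ∀ x → 1σ · x ≡ x
    ·-identityʳ : ∀ x → x · 1σ ≡ x
    ∥-monoʳ   : ∀ {x y} z → x ≤ y → (z ∥ x) ≤ (z ∥ y)
    ∥-⋁-distˡ : ∀ {I : Set c} (f : I → Carrier) y → (⋁ f) ∥ y ≡ ⋁ (λ i → f i ∥ y)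
    ∥-⋁-distʳ : ∀ {I : Set c} x (f : I → Carrier) → x ∥ (⋁ f) ≡ ⋁ (λ i → x ∥ f i)
    ∥-assoc   : ∀ x y z → (x ∥ y) ∥ z ≡ x ∥ (y ∥ z)
    ∥-comm    : ∀ x y → x ∥ y ≡ y ∥ x
    ∥-identityˡ : ∀ x → 1π ∥ x ≡ x
    ∥-identityʳ : ∀ x → x ∥ 1π ≡ x
    distrib : ∀ x y z → x ⊓ (y + z) ≡ (x ⊓ y) + (x ⊓ z)
    cl1  : ∀ x → x · 1π + x · 1̄π ≡ x · U
    cl2  : ∀ x → 1π ⊓ (x + 1̄π) ≡ x · 𝟘
    cl3  : ∀ x y z → (x · (y ∥ z)) ≤ ((x · y) ∥ (x · z))
    cl4  : ∀ x y z → (z ∥ z) ≤ z → (x ∥ y) · z ≡ (x · z) ∥ (y · z)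
    cl5  : ∀ x y z → x · (y · (z · 𝟘)) ≡ (x · y) · (z · 𝟘)
    cl6  : ∀ x y → (x · 𝟘) · y ≡ x · (𝟘 · y)
    cl7  : 1σ ∥ 1σ ≡ 1σ
    cl8  : ∀ x y → ((x · 1π) ∥ 1σ) · y ≡ (x · 1π) ∥ y
    cl9  : ∀ x → ((x ⊓ 1σ) · 1π) ∥ 1σ ≡ x ⊓ 1σ
    cl10 : ∀ x → ((x ⊓ 1̄π) · 1π) ∥ 1σ ≡ 1σ ⊓ ((x ⊓ 1̄π) · 1̄π)
    cl11 : ∀ x → ((x ⊓ 1̄π) · 1π) ∥ 1̄π ≡ (x ⊓ 1̄π) · 1̄π

  open IsCompleteLattice isCompleteLattice public

  d : Carrier → Carrier
  d x = (x · 1π) ∥ 1σ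

  IsDomain : Carrier → Set c
  IsDomain p = d p ≡ p

  ν : Carrier → Carrier
  ν x = x ⊓ 1̄π

  IsOmega : Carrier → Carrier → Set c
  IsOmega y w = (y · w ≡ w) × (∀ z → y · z ≡ z → z ≤ w)

  IsNabla : Carrier → Carrier → Set c
  IsNabla y p = IsDomain p × (p ≡ d (y · p))
                × (∀ q → IsDomain q → q ≡ d (y · q) → q ≤ p)

-- If p = ∇y with y = ν x ≤ 1̄π, then y · p ≤ 1̄π, and below 1̄π one has d z · U = z · U
-- (axioms cl8, cl11, cl1); with the hypothesis this gives y · (p · U) = d(y · p) · U = p · U,
-- so p · U ≤ y^ω. Conversely, for any y-fixpoint w, d w = d(y · w) = d(y · d w), so d w is
-- a candidate for ∇y; hence d w ≤ p and w ≤ d w · w ≤ d w · U ≤ p · U.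
module Submission where

open import Defs
open import Level using (Level; lift)
open import Data.Bool using (true; false)
open import Data.Product using (_,_; proj₁; proj₂)
open import Relation.Binary.Bundles using (Poset)
open import Relation.Binary.PropositionalEquality
  using (_≡_; refl; sym; trans; cong; cong₂; subst; isEquivalence; module ≡-Reasoning)

module CQuantaleProperties {c : Level} (S : CQuantale c) where
  open CQuantale S

  ≤-reflexive : ∀ {a b} → a ≡ b → a ≤ b
  ≤-reflexive refl = ≤-refl

  poset : Poset c c c
  poset = record
    { Carrier = Carrier
    ; _≈_ = _≡_
    ; _≤_ = _≤_
    ; isPartialOrder = record
      { isPreorder = record
        { isEquivalence = isEquivalence
        ; reflexive = ≤-reflexive
        ; trans = ≤-trans
        }
      ; antisym = ≤-antisym
      }
    }

  ⋁-cong : ∀ {I : Set c} {f g : I → Carrier} → (∀ i → f i ≡ g i) → ⋁ f ≡ ⋁ g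
  ⋁-cong {f = f} {g} f≡g = ≤-antisym
    (⋁-least f (⋁ g) (λ i → subst (_≤ ⋁ g) (sym (f≡g i)) (⋁-upper g i)))
    (⋁-least g (⋁ f) (λ i → subst (_≤ ⋁ f) (f≡g i) (⋁-upper f i)))

  U-maximum : ∀ a → a ≤ U
  U-maximum = ⋁-upper (λ z → z)

  𝟘-minimum : ∀ a → 𝟘 ≤ a
  𝟘-minimum a = ⋁-least _ a (λ ())

  x≤x+y : ∀ a b → a ≤ (a + b)
  x≤x+y a b = ⋁-upper _ (lift true)

  y≤x+y : ∀ a b → b ≤ (a + b)
  y≤x+y a b = ⋁-upper _ (lift false)

  +-lub : ∀ {a b z} → a ≤ z → b ≤ z → (a + b) ≤ z
  +-lub a≤z b≤z = ⋁-least _ _ (λ { (lift true) → a≤z ; (lift false) → b≤z })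

  x≤y⇒x+y≡y : ∀ {a b} → a ≤ b → a + b ≡ b
  x≤y⇒x+y≡y a≤b = ≤-antisym (+-lub a≤b ≤-refl) (y≤x+y _ _)

  x⊓y≤x : ∀ a b → (a ⊓ b) ≤ a
  x⊓y≤x a b = ⋁-least _ a (λ i → proj₁ (proj₂ i))

  x⊓y≤y : ∀ a b → (a ⊓ b) ≤ b
  x⊓y≤y a b = ⋁-least _ b (λ i → proj₂ (proj₂ i))

  x≤y⇒x⊓y≡x : ∀ {a b} → a ≤ b → a ⊓ b ≡ a
  x≤y⇒x⊓y≡x a≤b = ≤-antisym (x⊓y≤x _ _) (⋁-upper proj₁ (_ , ≤-refl , a≤b))

  ·-distribʳ-+ : ∀ z a b → (a + b) · z ≡ a · z + b · z
  ·-distribʳ-+ z a b = trans (·-⋁-distˡ _ z)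
    (⋁-cong (λ { (lift true) → refl ; (lift false) → refl }))

  ∥-distribˡ-+ : ∀ z a b → z ∥ (a + b) ≡ z ∥ a + z ∥ b
  ∥-distribˡ-+ z a b = trans (∥-⋁-distʳ z _)
    (⋁-cong (λ { (lift true) → refl ; (lift false) → refl }))

  ·-zeroˡ : ∀ a → 𝟘 · a ≡ 𝟘
  ·-zeroˡ a = ≤-antisym (≤-trans (≤-reflexive (·-⋁-distˡ _ a)) (⋁-least _ 𝟘 (λ ())))
                        (𝟘-minimum _)

  ·-monoˡ : ∀ {a b} z → a ≤ b → (a · z) ≤ (b · z)
  ·-monoˡ {a} {b} z a≤b = ≤-trans (x≤x+y (a · z) (b · z))
    (≤-reflexive (trans (sym (·-distribʳ-+ z a b)) (cong (_· z) (x≤y⇒x+y≡y a≤b))))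

  ∥-monoˡ : ∀ {a b} z → a ≤ b → (a ∥ z) ≤ (b ∥ z)
  ∥-monoˡ {a} {b} z a≤b =
    subst (_≤ (b ∥ z)) (∥-comm z a) (subst ((z ∥ a) ≤_) (∥-comm z b) (∥-monoʳ z a≤b))

  1π+1̄π≡U : 1π + 1̄π ≡ U
  1π+1̄π≡U = begin
    1π + 1̄π              ≡⟨ cong₂ _+_ (·-identityˡ 1π) (·-identityˡ 1̄π) ⟨
    1σ · 1π + 1σ · 1̄π    ≡⟨ cl1 1σ ⟩
    1σ · U               ≡⟨ ·-identityˡ U ⟩
    U                    ∎
    where open ≡-Reasoning

  x·𝟘≤1π : ∀ a → (a · 𝟘) ≤ 1π
  x·𝟘≤1π a = subst (_≤ 1π) (cl2 a) (x⊓y≤x 1π _)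

  1π·𝟘≡1π : 1π · 𝟘 ≡ 1π
  1π·𝟘≡1π = begin
    1π · 𝟘               ≡⟨ cl2 1π ⟨
    1π ⊓ (1π + 1̄π)       ≡⟨ cong (1π ⊓_) 1π+1̄π≡U ⟩
    1π ⊓ U               ≡⟨ x≤y⇒x⊓y≡x (U-maximum 1π) ⟩
    1π                   ∎
    where open ≡-Reasoning

  -- Axiom cl5 makes · associative whenever the right factor absorbs 𝟘 on the right,
  -- as both 𝟘 and 1π do.
  ·-assoc-𝟘-stable : ∀ a b {t} → t · 𝟘 ≡ t → a · (b · t) ≡ (a · b) · t
  ·-assoc-𝟘-stable a b {t} t𝟘≡t =
    subst (λ s → a · (b · s) ≡ (a · b) · s) t𝟘≡t (cl5 a b t)

  x·1π≤1π : ∀ a → (a · 1π) ≤ 1π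
  x·1π≤1π a = subst (_≤ 1π) [a·1π]·𝟘≡a·1π (x·𝟘≤1π (a · 1π))
    where
    [a·1π]·𝟘≡a·1π : (a · 1π) · 𝟘 ≡ a · 1π
    [a·1π]·𝟘≡a·1π = trans (sym (·-assoc-𝟘-stable a 1π (·-zeroˡ 𝟘))) (cong (a ·_) 1π·𝟘≡1π)

  d≤1σ : ∀ a → d a ≤ 1σ
  d≤1σ a = subst (d a ≤_) (∥-identityˡ 1σ) (∥-monoˡ 1σ (x·1π≤1π a))

  d[x]·1π≡x·1π : ∀ a → d a · 1π ≡ a · 1π
  d[x]·1π≡x·1π a = trans (cl8 a 1π) (∥-identityʳ _)

  d-idem : ∀ a → d (d a) ≡ d a
  d-idem a = cong (_∥ 1σ) (d[x]·1π≡x·1π a)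

  d[x·d[y]]≡d[x·y] : ∀ a b → d (a · d b) ≡ d (a · b)
  d[x·d[y]]≡d[x·y] a b = cong (_∥ 1σ) (begin
    (a · d b) · 1π       ≡⟨ ·-assoc-𝟘-stable a (d b) 1π·𝟘≡1π ⟨
    a · (d b · 1π)       ≡⟨ cong (a ·_) (d[x]·1π≡x·1π b) ⟩
    a · (b · 1π)         ≡⟨ ·-assoc-𝟘-stable a b 1π·𝟘≡1π ⟩
    (a · b) · 1π         ∎)
    where open ≡-Reasoning

  x≤d[x]·x : ∀ a → a ≤ (d a · a)
  x≤d[x]·x a = begin
    a                    ≡⟨ trans (cong (a ·_) (∥-identityˡ 1σ)) (·-identityʳ a) ⟨
    a · (1π ∥ 1σ)        ≤⟨ cl3 a 1π 1σ ⟩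
    (a · 1π) ∥ (a · 1σ)  ≡⟨ cong ((a · 1π) ∥_) (·-identityʳ a) ⟩
    (a · 1π) ∥ a         ≡⟨ cl8 a a ⟨
    d a · a              ∎
    where open import Relation.Binary.Reasoning.PartialOrder poset

  d[x]·U≡x·U : ∀ {a} → a ≤ 1̄π → d a · U ≡ a · U
  d[x]·U≡x·U {a} a≤1̄π = begin
    d a · U                          ≡⟨ cl8 a U ⟩
    (a · 1π) ∥ U                     ≡⟨ cong ((a · 1π) ∥_) 1π+1̄π≡U ⟨
    (a · 1π) ∥ (1π + 1̄π)             ≡⟨ ∥-distribˡ-+ (a · 1π) 1π 1̄π ⟩
    (a · 1π) ∥ 1π + (a · 1π) ∥ 1̄π    ≡⟨ cong₂ _+_ (∥-identityʳ (a · 1π)) cl11′ ⟩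
    a · 1π + a · 1̄π                  ≡⟨ cl1 a ⟩
    a · U                            ∎
    where
    open ≡-Reasoning
    cl11′ : (a · 1π) ∥ 1̄π ≡ a · 1̄π
    cl11′ = subst (λ t → (t · 1π) ∥ 1̄π ≡ t · 1̄π) (x≤y⇒x⊓y≡x a≤1̄π) (cl11 a)

  ν≤1̄π : ∀ a → ν a ≤ 1̄π
  ν≤1̄π a = x⊓y≤y a 1̄π

  d-fixpoint : ∀ {y w} → y · w ≡ w → d w ≡ d (y · d w)
  d-fixpoint {y} {w} yw≡w = trans (cong d (sym yw≡w)) (sym (d[x·d[y]]≡d[x·y] y w))

  ∇-fixpoint⇒·U-fixpoint : (∀ a b z → a · (d b · z) ≡ (a · d b) · z) →
    ∀ {y p} → y ≤ 1̄π → IsDomain p → p ≡ d (y · p) → y · (p · U) ≡ p · U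
  ∇-fixpoint⇒·U-fixpoint d-assoc {y} {p} y≤1̄π dp≡p p≡d[yp] = begin
    y · (p · U)          ≡⟨ cong (λ t → y · (t · U)) dp≡p ⟨
    y · (d p · U)        ≡⟨ d-assoc y p U ⟩
    (y · d p) · U        ≡⟨ cong (λ t → (y · t) · U) dp≡p ⟩
    (y · p) · U          ≡⟨ d[x]·U≡x·U yp≤1̄π ⟨
    d (y · p) · U        ≡⟨ cong (_· U) p≡d[yp] ⟨
    p · U                ∎
    where
    open ≡-Reasoning
    yp≤1̄π : (y · p) ≤ 1̄π
    yp≤1̄π = ≤-trans (·-monoʳ y (subst (_≤ 1σ) dp≡p (d≤1σ p)))
                    (subst (_≤ 1̄π) (sym (·-identityʳ y)) y≤1̄π)

proposition70 : ∀ {c : Level} (S : CQuantale c) → let open CQuantale S in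
    (∀ x y z → x · (d y · z) ≡ (x · d y) · z) →
    ∀ x (w p : Carrier) → IsOmega (ν x) w → IsNabla (ν x) p → w ≡ p · U
proposition70 S d-assoc x w p (yw≡w , w-greatest) (dp≡p , p≡d[yp] , p-greatest) =
  ≤-antisym w≤p·U p·U≤w
  where
  open CQuantale S
  open CQuantaleProperties S
  open import Relation.Binary.Reasoning.PartialOrder poset

  p·U≤w : (p · U) ≤ w
  p·U≤w = w-greatest (p · U)
    (∇-fixpoint⇒·U-fixpoint d-assoc (ν≤1̄π x) dp≡p p≡d[yp])

  w≤p·U : w ≤ (p · U)
  w≤p·U = begin
    w        ≤⟨ x≤d[x]·x w ⟩
    d w · w  ≤⟨ ·-monoʳ (d w) (U-maximum w) ⟩
    d w · U  ≤⟨ ·-monoˡ U (p-greatest (d w) (d-idem w) (d-fixpoint yw≡w)) ⟩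
    p · U    ∎
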